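{- For every set $\Gamma\cup\{\varphi\}\subseteq\mathcal{L}_{\Box\Diamond}(V)$: $\Gamma\vdash_{{}^\ast\mathcal{GK}^c}\varphi$ if and only if $\bigcup_{k\in\omega}\Box^k\Gamma\vdash_{\mathcal{GK}^c}\varphi$, where $\Box^0\psi:=\psi$, $\Box^{k+1}\psi:=\Box\Box^k\psi$ and $\Box^k\Gamma:=\{\Box^k\gamma:\gamma\in\Gamma\}$.
   Context: $V$ is a countable set of propositional variables. $\mathcal{L}_{\Box\Diamond}(V)$ is the set of formulas built from $V$ and $\bot$ with $\wedge,\vee,\rightarrow$ and unary $\Box,\Diamond$; $\top:=\bot\to\bot$, $\neg\varphi:=\varphi\to\bot$. $\mathcal{GK}^c$: Gödel–Dummett propositional calculus (intuitionistic calculus plus prelinearity $(\varphi\to\psi)\vee(\psi\to\varphi)$, modus ponens) over $\mathcal{L}_{\Box\Diamond}(V)$, plus axioms $\Box(\varphi\to\psi)\to(\Box\varphi\to\Box\psi)$, $\Diamond(\varphi\vee\psi)\to(\Diamond\varphi\vee\Diamond\psi)$, $\Diamond(\varphi\to\psi)\to(\Box\varphi\to\Diamond\psi)$, $(\Diamond\varphi\to\Box\psi)\to\Box(\varphi\to\psi)$, $\neg\Diamond\bot$, $\Box(\varphi\vee\psi)\to(\Box\varphi\vee\Diamond\psi)$, and rules applicable only to theorems: from $\varphi$ infer $\Box\varphi$; from $\varphi\to\psi$ infer $\Diamond\varphi\to\Diamond\psi$. ${}^\ast\mathcal{GK}^c$ is $\mathcal{GK}^c$ extended with the unrestricted rule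 $\varphi\vdash\Box\varphi$ (applicable to any derived formula, including those depending on premises). -}

module Defs where

open import Data.Nat using (ℕ; zero; suc)
open import Data.Empty using (⊥)
open import Data.Product using (∃; _×_)
open import Relation.Binary.PropositionalEquality using (_≡_)
open import Level using (0ℓ)
open import Relation.Unary using (Pred)

Var : Set
Var = ℕ

infixr 6 _∧_
infixr 5 _∨_
infixr 4 _⇒_

data Form : Set where
  var  : Var → Form
  ⊥'   : Form
  _∧_  : Form → Form → Form
  _∨_  : Form → Form → Form
  _⇒_  : Form → Form → Form
  □    : Form → Form
  ◇    : Form → Form

⊤' : Form
⊤' = ⊥' ⇒ ⊥'

¬' : Form → Form
¬' φ = φ ⇒ ⊥'

FSet : Set₁
FSet = Pred Form 0ℓ

∅ : FSet
∅ _ = ⊥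

data Axiom : Form → Set where
  ax-K     : ∀ φ ψ → Axiom (φ ⇒ ψ ⇒ φ)
  ax-S     : ∀ φ ψ χ → Axiom ((φ ⇒ ψ ⇒ χ) ⇒ (φ ⇒ ψ) ⇒ φ ⇒ χ)
  ax-∧I    : ∀ φ ψ → Axiom (φ ⇒ ψ ⇒ φ ∧ ψ)
  ax-∧E₁   : ∀ φ ψ → Axiom (φ ∧ ψ ⇒ φ)
  ax-∧E₂   : ∀ φ ψ → Axiom (φ ∧ ψ ⇒ ψ)
  ax-∨I₁   : ∀ φ ψ → Axiom (φ ⇒ φ ∨ ψ)
  ax-∨I₂   : ∀ φ ψ → Axiom (ψ ⇒ φ ∨ ψ)
  ax-∨E    : ∀ φ ψ χ → Axiom ((φ ⇒ χ) ⇒ (ψ ⇒ χ) ⇒ φ ∨ ψ ⇒ χ)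
  ax-⊥E    : ∀ φ → Axiom (⊥' ⇒ φ)
  ax-prelin : ∀ φ ψ → Axiom ((φ ⇒ ψ) ∨ (ψ ⇒ φ))
  ax-K□    : ∀ φ ψ → Axiom (□ (φ ⇒ ψ) ⇒ □ φ ⇒ □ ψ)
  ax-◇∨    : ∀ φ ψ → Axiom (◇ (φ ∨ ψ) ⇒ ◇ φ ∨ ◇ ψ)
  ax-K◇    : ∀ φ ψ → Axiom (◇ (φ ⇒ ψ) ⇒ □ φ ⇒ ◇ ψ)
  ax-FS    : ∀ φ ψ → Axiom ((◇ φ ⇒ □ ψ) ⇒ □ (φ ⇒ ψ))
  ax-¬◇⊥   : Axiom (¬' (◇ ⊥'))
  ax-□∨    : ∀ φ ψ → Axiom (□ (φ ∨ ψ) ⇒ □ φ ∨ ◇ ψ)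

-- Γ ⊢_{GK^c} φ : the necessitation and ◇-monotonicity rules apply only to
-- theorems (derivations from the empty set of premises).
data _⊢GK_ : FSet → Form → Set₁ where
  axm  : ∀ {Γ φ} → Axiom φ → Γ ⊢GK φ
  prem : ∀ {Γ φ} → Γ φ → Γ ⊢GK φ
  mp   : ∀ {Γ φ ψ} → Γ ⊢GK (φ ⇒ ψ) → Γ ⊢GK φ → Γ ⊢GK ψ
  nec  : ∀ {Γ φ} → ∅ ⊢GK φ → Γ ⊢GK □ φ
  mon◇ : ∀ {Γ φ ψ} → ∅ ⊢GK (φ ⇒ ψ) → Γ ⊢GK (◇ φ ⇒ ◇ ψ)

data _⊢GK*_ : FSet → Form → Set₁ where
  axm  : ∀ {Γ φ} → Axiom φ → Γ ⊢GK* φ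
  prem : ∀ {Γ φ} → Γ φ → Γ ⊢GK* φ
  mp   : ∀ {Γ φ ψ} → Γ ⊢GK* (φ ⇒ ψ) → Γ ⊢GK* φ → Γ ⊢GK* ψ
  nec  : ∀ {Γ φ} → ∅ ⊢GK* φ → Γ ⊢GK* □ φ
  mon◇ : ∀ {Γ φ ψ} → ∅ ⊢GK* (φ ⇒ ψ) → Γ ⊢GK* (◇ φ ⇒ ◇ ψ)
  nec* : ∀ {Γ φ} → Γ ⊢GK* φ → Γ ⊢GK* □ φ

□^ : ℕ → Form → Form
□^ zero    ψ = ψ
□^ (suc k) ψ = □ (□^ k ψ)

□ω : FSet → FSet
□ω Γ φ = ∃ λ k → ∃ λ γ → Γ γ × φ ≡ □^ k γ

-- A *GK^c-derivation is turned into a GK^c-derivation from ⋃ₖ □ᵏΓ by replacing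
-- each premise γ under k applications of the unrestricted rule by the premise
-- □ᵏγ; this works because GK^c derivations from a □-closed set of premises are
-- themselves closed under □, by necessitation on theorems and axiom K.
-- Conversely, each premise □ᵏγ is obtained in *GK^c from γ by k applications
-- of the unrestricted rule.
module Submission where

open import Defs
open import Data.Nat using (ℕ; zero; suc)
open import Data.Product using (_×_; _,_)
open import Relation.Binary.PropositionalEquality using (refl)
open import Relation.Unary using (_⊆_)

⊢GK-mono : ∀ {Δ Δ′ φ} → Δ ⊆ Δ′ → Δ ⊢GK φ → Δ′ ⊢GK φ
⊢GK-mono Δ⊆Δ′ (axm a)  = axm a
⊢GK-mono Δ⊆Δ′ (prem p) = prem (Δ⊆Δ′ p)
⊢GK-mono Δ⊆Δ′ (mp d e) = mp (⊢GK-mono Δ⊆Δ′ d) (⊢GK-mono Δ⊆Δ′ e)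
⊢GK-mono Δ⊆Δ′ (nec d)  = nec d
⊢GK-mono Δ⊆Δ′ (mon◇ d) = mon◇ d

⊢GK-nec-□closed : ∀ {Δ φ} → (∀ {ψ} → Δ ψ → Δ (□ ψ)) → Δ ⊢GK φ → Δ ⊢GK □ φ
⊢GK-nec-□closed Δ-□ (axm a)  = nec (axm a)
⊢GK-nec-□closed Δ-□ (prem p) = prem (Δ-□ p)
⊢GK-nec-□closed Δ-□ (mp {φ = χ} {ψ = ψ} d e) =
  mp (mp (axm (ax-K□ χ ψ)) (⊢GK-nec-□closed Δ-□ d)) (⊢GK-nec-□closed Δ-□ e)
⊢GK-nec-□closed Δ-□ (nec d)  = nec (nec d)
⊢GK-nec-□closed Δ-□ (mon◇ d) = nec (mon◇ d)

□ω-□closed : ∀ {Γ ψ} → □ω Γ ψ → □ω Γ (□ ψ)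
□ω-□closed (k , γ , γ∈Γ , refl) = suc k , γ , γ∈Γ , refl

□ω-∅ : □ω ∅ ⊆ ∅
□ω-∅ (_ , _ , () , _)

⊢GK*⇒⊢GK-□ω : ∀ {Γ φ} → Γ ⊢GK* φ → □ω Γ ⊢GK φ
⊢GK*⇒⊢GK-□ω (axm a)  = axm a
⊢GK*⇒⊢GK-□ω (prem p) = prem (0 , _ , p , refl)
⊢GK*⇒⊢GK-□ω (mp d e) = mp (⊢GK*⇒⊢GK-□ω d) (⊢GK*⇒⊢GK-□ω e)
⊢GK*⇒⊢GK-□ω (nec d)  = nec (⊢GK-mono □ω-∅ (⊢GK*⇒⊢GK-□ω d))
⊢GK*⇒⊢GK-□ω (mon◇ d) = mon◇ (⊢GK-mono □ω-∅ (⊢GK*⇒⊢GK-□ω d))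
⊢GK*⇒⊢GK-□ω (nec* d) = ⊢GK-nec-□closed □ω-□closed (⊢GK*⇒⊢GK-□ω d)

⊢GK⇒⊢GK* : ∀ {Γ φ} → Γ ⊢GK φ → Γ ⊢GK* φ
⊢GK⇒⊢GK* (axm a)  = axm a
⊢GK⇒⊢GK* (prem p) = prem p
⊢GK⇒⊢GK* (mp d e) = mp (⊢GK⇒⊢GK* d) (⊢GK⇒⊢GK* e)
⊢GK⇒⊢GK* (nec d)  = nec (⊢GK⇒⊢GK* d)
⊢GK⇒⊢GK* (mon◇ d) = mon◇ (⊢GK⇒⊢GK* d)

⊢GK*-nec^ : ∀ {Γ φ} k → Γ ⊢GK* φ → Γ ⊢GK* □^ k φ
⊢GK*-nec^ zero    d = d
⊢GK*-nec^ (suc k) d = nec* (⊢GK*-nec^ k d)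

⊢GK-□ω⇒⊢GK* : ∀ {Γ φ} → □ω Γ ⊢GK φ → Γ ⊢GK* φ
⊢GK-□ω⇒⊢GK* (axm a)                     = axm a
⊢GK-□ω⇒⊢GK* (prem (k , _ , γ∈Γ , refl)) = ⊢GK*-nec^ k (prem γ∈Γ)
⊢GK-□ω⇒⊢GK* (mp d e) = mp (⊢GK-□ω⇒⊢GK* d) (⊢GK-□ω⇒⊢GK* e)
⊢GK-□ω⇒⊢GK* (nec d)  = nec (⊢GK⇒⊢GK* d)
⊢GK-□ω⇒⊢GK* (mon◇ d) = mon◇ (⊢GK⇒⊢GK* d)

lemma9 : (Γ : FSet) (φ : Form) →
    ((Γ ⊢GK* φ → □ω Γ ⊢GK φ) × (□ω Γ ⊢GK φ → Γ ⊢GK* φ))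
lemma9 Γ φ = ⊢GK*⇒⊢GK-□ω , ⊢GK-□ω⇒⊢GK*
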